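{- Let $G$ be a connected chordal graph, $x\in V(G)$, $\ell$ a positive integer, and $u,v\in N^\ell(x)$ with $d(u,v)=p\ge 2$. Let $K_u$ and $K_v$ be the subgraphs induced by the sets of ancestors (with respect to $x$) of $u$ and of $v$, respectively, in $N^{\ell-\lfloor p/2\rfloor}(x)$; these are complete graphs. Then: (a) if $p$ is odd, $K_u$ and $K_v$ are adjacent; (b) if $p$ is even, $K_u$ and $K_v$ are adjacent or $V(K_u)\cap V(K_v)\neq\varnothing$.
   Context: A graph is chordal if every induced cycle is a triangle. $d$ denotes shortest-path distance in $G$. For integer $i\ge 0$, $N^i(x)=\{w\in V(G): d(w,x)=i\}$. A vertex $w\in N^i(x)$ is an ancestor (with respect to $x$) of a vertex $y\in N^m(x)$ with $i<m$ if there is a path in $G$ between $y$ and $w$ of length $m-i$. Two complete subgraphs (cliques) $K$ and $K^*$ of $G$ are adjacent if they are vertex-disjoint and there exist $a\in V(K)$, $b\in V(K^*)$ with $ab\in E(G)$. -}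

module Defs where

open import Data.Nat using (ℕ; zero; suc; _≤_; _<_; _∸_)
open import Data.Fin using (Fin; toℕ)
open import Data.Product using (Σ; ∃; _×_; _,_)
open import Data.Sum using (_⊎_)
open import Relation.Nullary using (¬_; Dec)
open import Relation.Binary.PropositionalEquality using (_≡_)
open import Function.Definitions using (Injective)
open import Function.Bundles using (_⇔_)

record Graph : Set₁ where
  field
    n      : ℕ
    Adj    : Fin n → Fin n → Set
    adj?   : ∀ u v → Dec (Adj u v)
    sym    : ∀ {u v} → Adj u v → Adj v u
    irrefl : ∀ {u} → ¬ Adj u u

module _ (G : Graph) where
  open Graph G

  data Walk : Fin n → Fin n → ℕ → Set where
    nil  : ∀ {u} → Walk u u 0
    cons : ∀ {u w v k} → Adj u w → Walk w v k → Walk u v (suc k)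

  Dist : Fin n → Fin n → ℕ → Set
  Dist u v k = Walk u v k × (∀ m → Walk u v m → k ≤ m)

  Connected : Set
  Connected = ∀ u v → ∃ λ k → Walk u v k

  CycSucc : (k : ℕ) → Fin k → Fin k → Set
  CycSucc k i j = (suc (toℕ i) ≡ toℕ j) ⊎ (suc (toℕ i) ≡ k × toℕ j ≡ 0)

  IsInducedCycle : (k : ℕ) → (Fin k → Fin n) → Set
  IsInducedCycle k c =
    3 ≤ k × Injective _≡_ _≡_ c ×
    (∀ i j → Adj (c i) (c j) ⇔ (CycSucc k i j ⊎ CycSucc k j i))

  Chordal : Set
  Chordal = ∀ k c → IsInducedCycle k c → k ≡ 3

  InN : ℕ → Fin n → Fin n → Set
  InN i x w = Dist w x i

  Ancestor : Fin n → ℕ → ℕ → Fin n → Fin n → Set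
  Ancestor x i m w y = i < m × InN i x w × InN m x y × Walk y w (m ∸ i)

  IsClique : (Fin n → Set) → Set
  IsClique S = ∀ a b → S a → S b → ¬ (a ≡ b) → Adj a b

  AdjacentCliques : (Fin n → Set) → (Fin n → Set) → Set
  AdjacentCliques K K* =
    (∀ w → ¬ (K w × K* w)) × (∃ λ a → ∃ λ b → K a × K* b × Adj a b)

  Intersect : (Fin n → Set) → (Fin n → Set) → Set
  Intersect K K* = ∃ λ w → K w × K* w

-- In a chordal graph, two vertices a, b at distance h from x that are joined by a walk whose
-- inner vertices all lie at distance > h from x are equal or adjacent. Otherwise shorten that walk,
-- and the walk b → x → a (inner vertices at distance < h), to induced paths: their inner vertices
-- can neither coincide nor be adjacent, so together they form an induced cycle of length ≥ 4.
--
-- Two ancestors of u are joined in this way through u, so they form a clique. For the adjacency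
-- claims write p = k + j with k = ⌊p/2⌋ and j ∈ {k, k+1}, h = ℓ − k, and let P be a shortest u–v
-- walk. Going through u or v, every vertex P_s is at distance ≥ h from x, with equality at most for
-- s = k and s = j. Take a = P_k if it is at distance h, and otherwise the ancestor of u on a
-- shortest u–x walk; choose b likewise from P_j and v. Either a, b are consecutive on P, or they
-- are joined through u, P and v by a walk staying beyond distance h; so a = b or ab is an edge.
-- For odd p a common ancestor would give a u–v walk of length 2k < p.

module Submission where

open import Defs
open import Data.Nat using (ℕ; zero; suc; _+_; _*_; _∸_; _≤_; _<_; z≤n; s≤s; z<s; _≤?_; _<?_; _≟_)
open import Data.Nat.Properties
open import Data.Nat.DivMod using (_/_; _%_; m≡m%n+[m/n]*n; m%n<n)
open import Data.Nat.Induction using (<-wellFounded)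
open import Data.Product using (Σ; ∃; ∃₂; _×_; _,_; proj₁; proj₂)
open import Data.Sum using (_⊎_; inj₁; inj₂; swap)
open import Data.Fin using (Fin; toℕ)
import Data.Fin.Properties as Fin
open import Data.Empty using (⊥; ⊥-elim)
open import Induction.WellFounded using (Acc; acc)
open import Relation.Nullary using (¬_; Dec; yes; no)
open import Relation.Nullary.Decidable using (_×-dec_; _⊎-dec_; ¬?)
open import Relation.Binary.PropositionalEquality
open import Function.Base using (_∘_)
open import Function.Bundles using (_⇔_; mk⇔)
open import Relation.Binary.Definitions using (tri<; tri≈; tri>)

module Walks (G : Graph) where
  open Graph G renaming (sym to adj-sym)

  private
    variable
      u v w : Fin n
      m k t s : ℕ

  -- Positions past the end of the walk give its last vertex.
  at : Walk G u v m → ℕ → Fin n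
  at {u} nil _ = u
  at {u} (cons _ _) zero = u
  at (cons _ q) (suc t) = at q t

  at-0 : (q : Walk G u v m) → at q 0 ≡ u
  at-0 nil = refl
  at-0 (cons _ _) = refl

  at-end : (q : Walk G u v m) → at q m ≡ v
  at-end nil = refl
  at-end (cons _ q) = at-end q

  at-step : (q : Walk G u v m) → t < m → Adj (at q t) (at q (suc t))
  at-step (cons a q) z<s = subst (Adj _) (sym (at-0 q)) a
  at-step (cons _ q) (s≤s (s≤s t<m)) = at-step q (s≤s t<m)

  walk? : ∀ (m : ℕ) (u v : Fin n) → Dec (Walk G u v m)
  walk? zero u v with u Fin.≟ v
  ... | yes refl = yes nil
  ... | no u≢v = no λ { nil → u≢v refl }
  walk? (suc m) u v with Fin.any? (λ w → adj? u w ×-dec walk? m w v)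
  ... | yes (w , a , q) = yes (cons a q)
  ... | no ∄ = no λ { (cons a q) → ∄ (_ , a , q) }

  dist? : ∀ (u v : Fin n) (m : ℕ) → Dec (Dist G u v m)
  dist? u v m with walk? m u v | allUpTo? (λ k → ¬? (walk? k u v)) m
  ... | no ∄ | _ = no λ d → ∄ (proj₁ d)
  ... | yes q | yes shorter = yes (q , λ k q′ → ≮⇒≥ λ k<m → shorter k<m q′)
  ... | yes q | no ¬shorter = no λ d → ¬shorter λ k<m q′ → <⇒≱ k<m (proj₂ d _ q′)

  infixr 5 _++_
  _++_ : Walk G u v m → Walk G v w k → Walk G u w (m + k)
  nil ++ q = q
  cons a p ++ q = cons a (p ++ q)

  at-++ˡ : (p : Walk G u v m) (q : Walk G v w k) → t ≤ m → at (p ++ q) t ≡ at p t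
  at-++ˡ nil q z≤n = at-0 q
  at-++ˡ {t = zero} (cons a p) q _ = refl
  at-++ˡ {t = suc t} (cons a p) q (s≤s t≤m) = at-++ˡ p q t≤m

  at-++ʳ : (p : Walk G u v m) (q : Walk G v w k) → m ≤ t → at (p ++ q) t ≡ at q (t ∸ m)
  at-++ʳ nil q _ = refl
  at-++ʳ (cons a p) q (s≤s m≤t) = at-++ʳ p q m≤t

  take : (q : Walk G u v m) (t : ℕ) → t ≤ m → Walk G u (at q t) t
  take q zero _ = subst (λ z → Walk G _ z 0) (sym (at-0 q)) nil
  take (cons a q) (suc t) (s≤s t≤m) = cons a (take q t t≤m)

  at-take : (q : Walk G u v m) (t≤m : t ≤ m) → s ≤ t → at (take q t t≤m) s ≡ at q s
  at-take {s = zero} q t≤m _ = trans (at-0 (take q _ t≤m)) (sym (at-0 q))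
  at-take {t = suc t} {s = suc s} (cons a q) (s≤s t≤m) (s≤s s≤t) = at-take q t≤m s≤t

  drop : (q : Walk G u v m) (t : ℕ) → Walk G (at q t) v (m ∸ t)
  drop nil zero = nil
  drop nil (suc t) = nil
  drop (cons a q) zero = cons a q
  drop (cons a q) (suc t) = drop q t

  at-drop : (q : Walk G u v m) (t s : ℕ) → at (drop q t) s ≡ at q (t + s)
  at-drop nil zero s = refl
  at-drop nil (suc t) s = refl
  at-drop (cons a q) zero s = refl
  at-drop (cons a q) (suc t) s = at-drop q t s

  infixl 5 _∷ʳ_
  _∷ʳ_ : Walk G u v m → Adj v w → Walk G u w (suc m)
  nil ∷ʳ a = cons a nil
  cons b q ∷ʳ a = cons b (q ∷ʳ a)

  at-∷ʳ : (q : Walk G u v m) (a : Adj v w) → t ≤ m → at (q ∷ʳ a) t ≡ at q t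
  at-∷ʳ nil a z≤n = refl
  at-∷ʳ {t = zero} (cons b q) a _ = refl
  at-∷ʳ {t = suc t} (cons b q) a (s≤s t≤m) = at-∷ʳ q a t≤m

  reverse : Walk G u v m → Walk G v u m
  reverse nil = nil
  reverse (cons a q) = reverse q ∷ʳ adj-sym a

  at-reverse : (q : Walk G u v m) → t ≤ m → at (reverse q) t ≡ at q (m ∸ t)
  at-reverse nil z≤n = refl
  at-reverse {m = suc m} {t = t} (cons a q) t≤1+m with m≤n⇒m<n∨m≡n t≤1+m
  ... | inj₁ (s≤s t≤m) = begin
    at (reverse q ∷ʳ adj-sym a) t ≡⟨ at-∷ʳ (reverse q) (adj-sym a) t≤m ⟩
    at (reverse q) t              ≡⟨ at-reverse q t≤m ⟩
    at q (m ∸ t)                  ≡⟨ cong (at (cons a q)) (sym (+-∸-assoc 1 t≤m)) ⟩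
    at (cons a q) (suc m ∸ t)     ∎
    where open ≡-Reasoning
  ... | inj₂ refl = trans (at-end (reverse q ∷ʳ adj-sym a)) (cong (at (cons a q)) (sym (n∸n≡0 t)))

  Inner : (Fin n → Set) → Walk G u v m → Set
  Inner {m = m} S q = ∀ {t} → 0 < t → t < m → S (at q t)

  private
    variable
      S : Fin n → Set

  inner-short : (q : Walk G u v m) → m ≤ 1 → Inner S q
  inner-short q m≤1 0<t t<m = ⊥-elim (<⇒≱ (<-≤-trans t<m m≤1) 0<t)

  inner-++ : (p : Walk G u v m) (q : Walk G v w k) → Inner S p → Inner S q →
             (0 < m → 0 < k → S v) → Inner S (p ++ q)
  inner-++ {m = m} {k = k} {S = S} p q inP inQ junction {t} 0<t t<m+k with t ≤? m
  ... | no t≰m = subst S (sym (at-++ʳ p q m≤t)) (inQ (m<n⇒0<n∸m m<t) t∸m<k)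
    where
    m<t : m < t
    m<t = ≰⇒> t≰m
    m≤t : m ≤ t
    m≤t = <⇒≤ m<t
    t∸m<k : t ∸ m < k
    t∸m<k = +-cancelˡ-< m (t ∸ m) k (subst (_< m + k) (sym (m+[n∸m]≡n m≤t)) t<m+k)
  ... | yes t≤m with m≤n⇒m<n∨m≡n t≤m
  ...   | inj₁ t<m = subst S (sym (at-++ˡ p q t≤m)) (inP 0<t t<m)
  ...   | inj₂ refl = subst S (sym (trans (at-++ˡ p q t≤m) (at-end p)))
                        (junction 0<t (+-cancelˡ-< t 0 k (subst (_< t + k) (sym (+-identityʳ t)) t<m+k)))

  inner-reverse : (q : Walk G u v m) → Inner S q → Inner S (reverse q)
  inner-reverse {m = m} {S = S} q inQ {t} 0<t t<m =
    subst S (sym (at-reverse q (<⇒≤ t<m))) (inQ (m<n⇒0<n∸m t<m) (∸-monoʳ-< 0<t (<⇒≤ t<m)))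

  record Path (S : Fin n → Set) (a b : Fin n) : Set where
    constructor path
    field
      {len} : ℕ
      walk  : Walk G a b len
      inner : Inner S walk

  infixr 5 _⟨_⟩_
  _⟨_⟩_ : Path S u v → S v → Path S v w → Path S u w
  _⟨_⟩_ {S = S} (path p inP) Sv (path q inQ) = path (p ++ q) (inner-++ {S = S} p q inP inQ λ _ _ → Sv)

  reversePath : Path S u v → Path S v u
  reversePath {S = S} (path q inQ) = path (reverse q) (inner-reverse {S = S} q inQ)

  Shortcut : Walk G u v m → ℕ → ℕ → Set
  Shortcut q i j = at q i ≡ at q j ⊎ (suc i < j × Adj (at q i) (at q j))

  Induced : Walk G u v m → Set
  Induced {m = m} q = ∀ {i j} → i < j → j ≤ m → ¬ Shortcut q i j

  induced-or-shortcut : (q : Walk G u v m) →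
    Induced q ⊎ ∃₂ λ i j → i < j × j ≤ m × Shortcut q i j
  induced-or-shortcut {m = m} q
    with anyUpTo? (λ j → anyUpTo? (λ i → shortcut? i j) j) (suc m)
    where
    shortcut? : ∀ i j → Dec (Shortcut q i j)
    shortcut? i j = (at q i Fin.≟ at q j) ⊎-dec ((suc i <? j) ×-dec adj? (at q i) (at q j))
  ... | yes (j , s≤s j≤m , i , i<j , sc) = inj₂ (i , j , i<j , j≤m , sc)
  ... | no ∄ = inj₁ λ {i} {j} i<j j≤m sc → ∄ (j , s≤s j≤m , i , i<j , sc)

  shortcut-walk : (q : Walk G u v m) {i j : ℕ} → i < j → Shortcut q i j →
    ∃ λ b → b ≤ 1 × i + b < j × Walk G (at q i) (at q j) b
  shortcut-walk q {i} {j} i<j (inj₁ qi≡qj) =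
    0 , z≤n , subst (_< j) (sym (+-identityʳ i)) i<j , subst (λ z → Walk G _ z 0) qi≡qj nil
  shortcut-walk q {i} {j} _ (inj₂ (1+i<j , a)) =
    1 , ≤-refl , subst (_< j) (+-comm 1 i) 1+i<j , cons a nil

  shorten : (q : Walk G u v m) → Inner S q → {i j : ℕ} → i < j → j ≤ m → Shortcut q i j →
    ∃ λ m′ → m′ < m × Σ (Walk G u v m′) (Inner S)
  shorten {u = u} {v = v} {m = m} {S = S} q inQ {i} {j} i<j j≤m sc with shortcut-walk q i<j sc
  ... | b , b≤1 , i+b<j , bridge =
    i + (b + (m ∸ j)) , shorter ,
    prefix ++ rest , inner-++ {S = S} prefix rest inPrefix inRest (λ 0<i _ → inQ 0<i i<m)
    where
    i<m : i < m
    i<m = <-≤-trans i<j j≤m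
    i≤m : i ≤ m
    i≤m = <⇒≤ i<m
    prefix : Walk G u (at q i) i
    prefix = take q i i≤m
    rest : Walk G (at q i) v (b + (m ∸ j))
    rest = bridge ++ drop q j
    inPrefix : Inner S prefix
    inPrefix {t} 0<t t<i = subst S (sym (at-take q i≤m (<⇒≤ t<i))) (inQ 0<t (<-trans t<i i<m))
    inDrop : Inner S (drop q j)
    inDrop {s} 0<s s<m∸j = subst S (sym (at-drop q j s))
      (inQ (<-≤-trans 0<s (m≤n+m s j)) (subst (j + s <_) (m+[n∸m]≡n j≤m) (+-monoʳ-< j s<m∸j)))
    inRest : Inner S rest
    inRest = inner-++ {S = S} bridge (drop q j) (inner-short {S = S} bridge b≤1) inDrop
      λ _ 0<m∸j → inQ (≤-trans (s≤s z≤n) i<j) (m∸n≢0⇒n<m (n>0⇒n≢0 0<m∸j))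
    shorter : i + (b + (m ∸ j)) < m
    shorter = begin-strict
      i + (b + (m ∸ j)) ≡⟨ +-assoc i b (m ∸ j) ⟨
      i + b + (m ∸ j)   <⟨ +-monoˡ-< (m ∸ j) i+b<j ⟩
      j + (m ∸ j)       ≡⟨ m+[n∸m]≡n j≤m ⟩
      m                 ∎
      where open ≤-Reasoning

  walk-length≥2 : u ≢ v → ¬ Adj u v → Walk G u v m → 2 ≤ m
  walk-length≥2 u≢v ¬uv nil = ⊥-elim (u≢v refl)
  walk-length≥2 u≢v ¬uv (cons uv nil) = ⊥-elim (¬uv uv)
  walk-length≥2 u≢v ¬uv (cons _ (cons _ _)) = s≤s (s≤s z≤n)

  induce : Path S u v → Σ (Path S u v) (Induced ∘ Path.walk)
  induce {S = S} (path q inQ) = go (<-wellFounded _) q inQ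
    where
    go : Acc _<_ m → (q : Walk G u v m) → Inner S q → Σ (Path S u v) (Induced ∘ Path.walk)
    go (acc shorter) q inQ with induced-or-shortcut q
    ... | inj₁ ind = path q inQ , ind
    ... | inj₂ (i , j , i<j , j≤m , sc) with shorten {S = S} q inQ i<j j≤m sc
    ...   | m′ , m′<m , q′ , inQ′ = go (shorter m′<m) q′ inQ′

data Split (m : ℕ) : ℕ → Set where
  first  : ∀ {t} → t ≤ m → Split m t
  second : ∀ s → Split m (m + suc s)

split : ∀ m t → Split m t
split m t with t ≤? m
... | yes t≤m = first t≤m
... | no t≰m with m≤n⇒∃[o]m+o≡n (≰⇒> t≰m)
...   | s , refl = subst (Split m) (+-suc m s) (second s)

module ChordalGraph (G : Graph) (chordal : Chordal G) where
  open Graph G renaming (sym to adj-sym)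
  open Walks G

  private
    variable
      a b : Fin n
      m m′ : ℕ
      S T : Fin n → Set

  chordless-closed-walk⇒⊥ : {k : ℕ} (c : Walk G a a k) → 4 ≤ k →
    (∀ {i j} → i < j → j < k → at c i ≢ at c j) →
    (∀ {i j} → suc i < j → j < k → ¬ (i ≡ 0 × suc j ≡ k) → ¬ Adj (at c i) (at c j)) → ⊥
  chordless-closed-walk⇒⊥ {k = k} c 4≤k distinct chordless = <-irrefl (sym k≡3) 4≤k
    where
    C : ℕ → Fin n
    C = at c

    Follows : ℕ → ℕ → Set
    Follows i j = suc i ≡ j ⊎ (suc i ≡ k × j ≡ 0)

    follows⇒adj : ∀ {i j} → i < k → Follows i j → Adj (C i) (C j)
    follows⇒adj i<k (inj₁ refl) = at-step c i<k
    follows⇒adj i<k (inj₂ (refl , refl)) = subst (Adj _) (trans (at-end c) (sym (at-0 c))) (at-step c i<k)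

    adj⇒follows : ∀ {i j} → i < j → j < k → Adj (C i) (C j) → Follows i j ⊎ Follows j i
    adj⇒follows {i} {j} i<j j<k ij with suc i ≟ j | (i ≟ 0) ×-dec (suc j ≟ k)
    ... | yes 1+i≡j | _ = inj₁ (inj₁ 1+i≡j)
    ... | no _ | yes (refl , 1+j≡k) = inj₂ (inj₂ (1+j≡k , refl))
    ... | no 1+i≢j | no wrap = ⊥-elim (chordless (≤∧≢⇒< i<j 1+i≢j) j<k wrap ij)

    cyc : Fin k → Fin n
    cyc i = C (toℕ i)

    cyc-injective : ∀ {i j} → cyc i ≡ cyc j → i ≡ j
    cyc-injective {i} {j} eq with <-cmp (toℕ i) (toℕ j)
    ... | tri< i<j _ _ = ⊥-elim (distinct i<j (Fin.toℕ<n j) eq)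
    ... | tri≈ _ i≡j _ = Fin.toℕ-injective i≡j
    ... | tri> _ _ j<i = ⊥-elim (distinct j<i (Fin.toℕ<n i) (sym eq))

    adj⇔cyclic : ∀ i j → Adj (cyc i) (cyc j) ⇔ (CycSucc G k i j ⊎ CycSucc G k j i)
    adj⇔cyclic i j = mk⇔ to from
      where
      to : Adj (cyc i) (cyc j) → CycSucc G k i j ⊎ CycSucc G k j i
      to ij with <-cmp (toℕ i) (toℕ j)
      ... | tri< i<j _ _ = adj⇒follows i<j (Fin.toℕ<n j) ij
      ... | tri≈ _ i≡j _ = ⊥-elim (irrefl (subst (λ z → Adj (cyc i) (C z)) (sym i≡j) ij))
      ... | tri> _ _ j<i = swap (adj⇒follows j<i (Fin.toℕ<n i) (adj-sym ij))
      from : CycSucc G k i j ⊎ CycSucc G k j i → Adj (cyc i) (cyc j)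
      from (inj₁ ij) = follows⇒adj (Fin.toℕ<n i) ij
      from (inj₂ ji) = adj-sym (follows⇒adj (Fin.toℕ<n j) ji)

    k≡3 : k ≡ 3
    k≡3 = chordal k cyc (≤-trans (n≤1+n 3) 4≤k , cyc-injective , adj⇔cyclic)

  separated-induced-paths⇒⊥ : (p : Walk G a b m) (q : Walk G b a m′) → Induced p → Induced q →
    2 ≤ m → 2 ≤ m′ → Inner S p → Inner T q →
    (∀ {y z} → S y → T z → ¬ (y ≡ z ⊎ Adj y z)) → ⊥
  separated-induced-paths⇒⊥ {m = m} {m′ = m′} p q indP indQ 2≤m 2≤m′ inP inQ apart =
    chordless-closed-walk⇒⊥ (p ++ q) (+-mono-≤ 2≤m 2≤m′) distinct chordless
    where
    C : ℕ → Fin n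
    C = at (p ++ q)

    onP : ∀ {i} → i ≤ m → C i ≡ at p i
    onP = at-++ˡ p q

    onQ : ∀ s → C (m + s) ≡ at q s
    onQ s = trans (at-++ʳ p q (m≤m+n m s)) (cong (at q) (m+n∸m≡n m s))

    start : C 0 ≡ at q m′
    start = trans (onP z≤n) (trans (at-0 p) (sym (at-end q)))

    middle : C m ≡ at q 0
    middle = trans (onP ≤-refl) (trans (at-end p) (sym (at-0 q)))

    boundary-or-inner : ∀ {i} → i ≤ m → i ≡ 0 ⊎ i ≡ m ⊎ (0 < i × i < m)
    boundary-or-inner {zero} _ = inj₁ refl
    boundary-or-inner {suc i} i≤m with m≤n⇒m<n∨m≡n i≤m
    ... | inj₁ i<m = inj₂ (inj₂ (z<s , i<m))
    ... | inj₂ i≡m = inj₂ (inj₁ i≡m)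

    along-p : (R : Fin n → Fin n → Set) {i j : ℕ} → i ≤ m → j ≤ m →
              R (C i) (C j) → R (at p i) (at p j)
    along-p R i≤m j≤m = subst₂ R (onP i≤m) (onP j≤m)

    along-q : (R : Fin n → Fin n → Set) (s s′ : ℕ) →
              R (C (m + s)) (C (m + s′)) → R (at q s) (at q s′)
    along-q R s s′ = subst₂ R (onQ s) (onQ s′)

    in-q : ∀ {s} → m + s < m + m′ → s < m′
    in-q {s} = +-cancelˡ-< m s m′

    distinct : ∀ {i j} → i < j → j < m + m′ → C i ≢ C j
    distinct {i} {j} i<j j<K Ci≡Cj with split m i | split m j
    ... | _ | first j≤m = indP i<j j≤m (inj₁ (along-p _≡_ (≤-trans (<⇒≤ i<j) j≤m) j≤m Ci≡Cj))
    ... | second s | second s′ =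
      indQ (+-cancelˡ-< m (suc s) (suc s′) i<j) (<⇒≤ (in-q j<K))
        (inj₁ (along-q _≡_ (suc s) (suc s′) Ci≡Cj))
    ... | first i≤m | second s′ with boundary-or-inner i≤m
    ...   | inj₁ refl = indQ (in-q j<K) ≤-refl (inj₁ (subst₂ _≡_ (onQ (suc s′)) start (sym Ci≡Cj)))
    ...   | inj₂ (inj₁ refl) =
      indQ z<s (<⇒≤ (in-q j<K)) (inj₁ (subst₂ _≡_ middle (onQ (suc s′)) Ci≡Cj))
    ...   | inj₂ (inj₂ (0<i , i<m)) =
      apart (inP 0<i i<m) (inQ z<s (in-q j<K)) (inj₁ (subst₂ _≡_ (onP i≤m) (onQ (suc s′)) Ci≡Cj))

    chordless : ∀ {i j} → suc i < j → j < m + m′ → ¬ (i ≡ 0 × suc j ≡ m + m′) →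
                ¬ Adj (C i) (C j)
    chordless {i} {j} 1+i<j j<K no-wrap CiCj with split m i | split m j
    ... | _ | first j≤m =
      indP i<j j≤m (inj₂ (1+i<j , along-p Adj (≤-trans (<⇒≤ i<j) j≤m) j≤m CiCj))
      where
      i<j : i < j
      i<j = <-trans (n<1+n i) 1+i<j
    ... | second s | second s′ =
      indQ (+-cancelˡ-< m (suc s) (suc s′) (<-trans (n<1+n _) 1+i<j)) (<⇒≤ (in-q j<K))
        (inj₂ (+-cancelˡ-< m (2 + s) (suc s′) (subst (_< j) (sym (+-suc m (suc s))) 1+i<j) ,
               along-q Adj (suc s) (suc s′) CiCj))
    ... | first i≤m | second s′ with boundary-or-inner i≤m
    ...   | inj₁ refl =
      indQ (in-q j<K) ≤-refl (inj₂ (2+s′<m′ , adj-sym (subst₂ Adj start (onQ (suc s′)) CiCj)))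
      where
      2+s′<m′ : 2 + s′ < m′
      2+s′<m′ = ≤∧≢⇒< (in-q j<K) λ 2+s′≡m′ →
        no-wrap (refl , trans (sym (+-suc m (suc s′))) (cong (m +_) 2+s′≡m′))
    ...   | inj₂ (inj₁ refl) = indQ z<s (<⇒≤ (in-q j<K))
      (inj₂ (+-cancelˡ-< i 1 (suc s′) (subst (_< j) (+-comm 1 i) 1+i<j) ,
             subst₂ Adj middle (onQ (suc s′)) CiCj))
    ...   | inj₂ (inj₂ (0<i , i<m)) =
      apart (inP 0<i i<m) (inQ z<s (in-q j<K)) (inj₂ (subst₂ Adj (onP i≤m) (onQ (suc s′)) CiCj))

m+n≤o+p⇒o≤n⇒m≤p : ∀ {a b c d} → a + b ≤ c + d → c ≤ b → a ≤ d
m+n≤o+p⇒o≤n⇒m≤p {a} {b} {c} {d} le c≤b =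
  +-cancelʳ-≤ b a d (≤-trans le (subst (c + d ≤_) (+-comm b d) (+-monoˡ-≤ d c≤b)))

m+n≤o+p⇒p≤m⇒n≤o : ∀ {a b c d} → a + b ≤ c + d → d ≤ a → b ≤ c
m+n≤o+p⇒p≤m⇒n≤o {a} {b} {c} {d} le = m+n≤o+p⇒o≤n⇒m≤p (subst₂ _≤_ (+-comm a b) (+-comm c d) le)

module Layers (G : Graph) (x : Fin (Graph.n G)) where
  open Graph G renaming (sym to adj-sym)
  open Walks G

  private
    variable
      a b w y z : Fin n
      h i m k t : ℕ

  Beyond : ℕ → Fin n → Set
  Beyond h y = ∀ {M} → Walk G y x M → h < M

  Within : ℕ → Fin n → Set
  Within h y = ∃ λ M → M < h × Walk G y x M

  beyond-within-apart : Beyond h y → Within h z → ¬ (y ≡ z ⊎ Adj y z)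
  beyond-within-apart far (M , M<h , q) (inj₁ refl) = <-asym (far q) M<h
  beyond-within-apart far (M , M<h , q) (inj₂ yz) = <⇒≱ (far (cons yz q)) M<h

  dist-beyond : Dist G y x m → h < m → Beyond h y
  dist-beyond dy h<m q = <-≤-trans h<m (proj₂ dy _ q)

  walk-within : (q : Walk G y x h) → Inner (Within h) q
  walk-within {h = h} q {t} 0<t t<h = h ∸ t , ∸-monoʳ-< 0<t (<⇒≤ t<h) , drop q t

  geodesic-vertex-dist : (dy : Dist G y x m) → t ≤ m → Dist G (at (proj₁ dy) t) x (m ∸ t)
  geodesic-vertex-dist {m = m} {t = t} (q , shortest) t≤m =
    drop q t , λ M r → m≤n+o⇒m∸n≤o m t (shortest (t + M) (take q t t≤m ++ r))

  descent-beyond : Dist G y x m → (q : Walk G y w k) → i + k ≤ m → t < k → Beyond i (at q t)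
  descent-beyond {m = m} {k = k} {i = i} {t = t} (_ , shortest) q i+k≤m t<k {M} r =
    m+n≤o+p⇒o≤n⇒m≤p (begin
      suc i + t ≡⟨ +-suc i t ⟨
      i + suc t ≤⟨ +-monoʳ-≤ i t<k ⟩
      i + k     ≤⟨ i+k≤m ⟩
      m         ≤⟨ shortest (t + M) (take q t (<⇒≤ t<k) ++ r) ⟩
      t + M     ∎) ≤-refl
    where open ≤-Reasoning

  ancestor-path : Ancestor G x i m w y → Path (Beyond i) y w
  ancestor-path (i<m , _ , dy , q) =
    path q λ _ → descent-beyond dy q (≤-reflexive (m+[n∸m]≡n (<⇒≤ i<m)))

  ancestor-dist : Ancestor G x i m w y → Dist G w x i
  ancestor-dist (_ , dw , _ , _) = dw

  descendant-beyond : Ancestor G x i m w y → Beyond i y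
  descendant-beyond (i<m , _ , dy , _) = dist-beyond dy i<m

  geodesic-ancestor : Dist G y x m → i < m → ∃ λ w → Ancestor G x i m w y
  geodesic-ancestor {m = m} {i = i} dy i<m =
    at (proj₁ dy) (m ∸ i) ,
    i<m , subst (Dist G _ x) (m∸[m∸n]≡n (<⇒≤ i<m)) (geodesic-vertex-dist dy (m∸n≤m m i)) , dy ,
    take (proj₁ dy) (m ∸ i) (m∸n≤m m i)

  ancestor? : ∀ i m w y → Dec (Ancestor G x i m w y)
  ancestor? i m w y = (i <? m) ×-dec dist? w x i ×-dec dist? y x m ×-dec walk? (m ∸ i) y w

  shared-ancestor⇒dist≤ : ∀ {u v p} → Ancestor G x i m w u → Ancestor G x i m w v → Dist G u v p →
    p ≤ (m ∸ i) + (m ∸ i)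
  shared-ancestor⇒dist≤ (_ , _ , _ , q) (_ , _ , _ , r) (_ , shortest) = shortest _ (q ++ reverse r)

  path-through-x : Dist G a x h → Dist G b x h → Path (Within h) a b
  path-through-x {h = h} (q , _) (r , _) =
    path (q ++ reverse r) (inner-++ {S = Within h} q (reverse r) (walk-within q)
                             (inner-reverse {S = Within h} r (walk-within r)) λ 0<h _ → 0 , 0<h , nil)

  module _ (chordal : Chordal G) where
    open ChordalGraph G chordal

    beyond-path⇒≡⊎adj : Dist G a x h → Dist G b x h → Path (Beyond h) a b → a ≡ b ⊎ Adj a b
    beyond-path⇒≡⊎adj {a} {h} {b} da db up with a Fin.≟ b | adj? a b
    ... | yes a≡b | _ = inj₁ a≡b
    ... | no _ | yes ab = inj₂ ab
    ... | no a≢b | no ¬ab with induce up | induce (path-through-x db da)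
    ...   | path U inU , indU | path D inD , indD =
      ⊥-elim (separated-induced-paths⇒⊥ U D indU indD (walk-length≥2 a≢b ¬ab U)
                (walk-length≥2 (a≢b ∘ sym) (¬ab ∘ adj-sym) D) inU inD beyond-within-apart)

    ancestors-isClique : IsClique G (λ w → Ancestor G x i m w y)
    ancestors-isClique a b A B a≢b
      with beyond-path⇒≡⊎adj (ancestor-dist A) (ancestor-dist B)
             (reversePath (ancestor-path A) ⟨ descendant-beyond A ⟩ ancestor-path B)
    ... | inj₁ a≡b = ⊥-elim (a≢b a≡b)
    ... | inj₂ ab = ab

module Geodesic (G : Graph) (chordal : Chordal G) (x : Fin (Graph.n G))
  {ℓ k j : ℕ} {u v : Fin (Graph.n G)} (du : Dist G u x ℓ) (dv : Dist G v x ℓ) (duv : Dist G u v (k + j))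
  (0<k : 0 < k) (k≤j : k ≤ j) (j≤1+k : j ≤ suc k) where
  open Graph G using (n; Adj)
  open Walks G
  open Layers G x

  private
    variable
      s M : ℕ

  p : ℕ
  p = k + j

  P : Walk G u v p
  P = proj₁ duv

  h : ℕ
  h = ℓ ∸ k

  Anc : Fin n → Fin n → Set
  Anc w y = Ancestor G x h ℓ w y

  k≤ℓ : k ≤ ℓ
  k≤ℓ = ≮⇒≥ λ ℓ<k → <⇒≱ (+-mono-< ℓ<k ℓ<k) (begin
    k + k ≤⟨ +-monoʳ-≤ k k≤j ⟩
    p     ≤⟨ proj₂ duv _ (proj₁ du ++ reverse (proj₁ dv)) ⟩
    ℓ + ℓ ∎)
    where open ≤-Reasoning

  ℓ≡h+k : ℓ ≡ h + k
  ℓ≡h+k = sym (m∸n+n≡m k≤ℓ)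

  ℓ∸h≡k : ℓ ∸ h ≡ k
  ℓ∸h≡k = m∸[m∸n]≡n k≤ℓ

  h<ℓ : h < ℓ
  h<ℓ = ∸-monoʳ-< 0<k k≤ℓ

  k≤p : k ≤ p
  k≤p = m≤m+n k j

  j≤p : j ≤ p
  j≤p = m≤n+m j k

  to-ancestor : ∀ {w y} → Dist G w x h → Dist G y x ℓ → Walk G y w k → Anc w y
  to-ancestor dw dy q = h<ℓ , dw , dy , subst (Walk G _ _) (sym ℓ∸h≡k) q

  ancestor-at-k : Dist G (at P k) x h → Anc (at P k) u
  ancestor-at-k dk = to-ancestor dk du (take P k k≤p)

  ancestor-at-j : Dist G (at P j) x h → Anc (at P j) v
  ancestor-at-j dj = to-ancestor dj dv (subst (Walk G v _) (m+n∸n≡m k j) (reverse (drop P j)))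

  distance-bounds : s ≤ p → Walk G (at P s) x M → h + k ≤ s + M × h + k ≤ (p ∸ s) + M
  distance-bounds {s} s≤p r = subst (_≤ _) ℓ≡h+k (proj₂ du _ (take P s s≤p ++ r)) ,
                              subst (_≤ _) ℓ≡h+k (proj₂ dv _ (reverse (drop P s) ++ r))

  level≥h : s ≤ p → Walk G (at P s) x M → h ≤ M
  level≥h {s} s≤p r with s ≤? k
  ... | yes s≤k = m+n≤o+p⇒o≤n⇒m≤p (proj₁ (distance-bounds s≤p r)) s≤k
  ... | no s≰k = m+n≤o+p⇒o≤n⇒m≤p (proj₂ (distance-bounds s≤p r)) (m≤n+o⇒m∸n≤o p s (begin
    k + j ≤⟨ +-monoʳ-≤ k (≤-trans j≤1+k (≰⇒> s≰k)) ⟩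
    k + s ≡⟨ +-comm k s ⟩
    s + k ∎))
    where open ≤-Reasoning

  between-k-and-j : k ≤ s → s ≤ j → s ≡ k ⊎ s ≡ j
  between-k-and-j k≤s s≤j with m≤n⇒m<n∨m≡n s≤j
  ... | inj₁ s<j = inj₁ (≤-antisym (≤-pred (<-≤-trans s<j j≤1+k)) k≤s)
  ... | inj₂ s≡j = inj₂ s≡j

  level≤h⇒middle : s ≤ p → Walk G (at P s) x M → M ≤ h → s ≡ k ⊎ s ≡ j
  level≤h⇒middle {s} {M} s≤p r M≤h = between-k-and-j k≤s s≤j
    where
    k≤s : k ≤ s
    k≤s = m+n≤o+p⇒p≤m⇒n≤o (proj₁ (distance-bounds s≤p r)) M≤h
    k≤p∸s : k ≤ p ∸ s
    k≤p∸s = m+n≤o+p⇒p≤m⇒n≤o (proj₂ (distance-bounds s≤p r)) M≤h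
    s≤j : s ≤ j
    s≤j = +-cancelˡ-≤ k s j (begin
      k + s       ≤⟨ +-monoˡ-≤ s k≤p∸s ⟩
      p ∸ s + s   ≡⟨ m∸n+n≡m s≤p ⟩
      k + j       ∎)
      where open ≤-Reasoning

  beyond-off-middle : s ≤ p → (s ≡ k → Beyond h (at P k)) → (s ≡ j → Beyond h (at P j)) →
                      Beyond h (at P s)
  beyond-off-middle {s} s≤p at-k at-j {M} r with h <? M
  ... | yes h<M = h<M
  ... | no h≮M with level≤h⇒middle s≤p r (≮⇒≥ h≮M)
  ...   | inj₁ refl = at-k refl r
  ...   | inj₂ refl = at-j refl r

  ancestor-or-beyond : s ≤ p → Dist G (at P s) x h ⊎ Beyond h (at P s)
  ancestor-or-beyond {s} s≤p with dist? (at P s) x h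
  ... | yes ds = inj₁ ds
  ... | no ¬ds = inj₂ λ r → ≤∧≢⇒< (level≥h s≤p r)
                   λ { refl → ¬ds (r , λ _ r′ → level≥h s≤p r′) }

  consecutive-k-j : at P k ≡ at P j ⊎ Adj (at P k) (at P j)
  consecutive-k-j with m≤n⇒m<n∨m≡n k≤j
  ... | inj₂ k≡j = inj₁ (cong (at P) k≡j)
  ... | inj₁ k<j =
    inj₂ (subst (λ i → Adj (at P k) (at P i)) (≤-antisym k<j j≤1+k) (at-step P (<-≤-trans k<j j≤p)))

  path-from-k : Beyond h (at P j) → Path (Beyond h) (at P k) v
  path-from-k bj = path (drop P k) λ {s} 0<s s<p∸k → subst (Beyond h) (sym (at-drop P k s))
    (beyond-off-middle (≤-trans (+-monoʳ-≤ k (<⇒≤ s<p∸k)) (≤-reflexive (m+[n∸m]≡n k≤p)))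
      (λ k+s≡k → ⊥-elim (<-irrefl (sym k+s≡k) (m<m+n k 0<s))) λ _ → bj)

  path-to-j : Beyond h (at P k) → Path (Beyond h) u (at P j)
  path-to-j bk = path (take P j j≤p) λ {s} 0<s s<j → subst (Beyond h) (sym (at-take P j≤p (<⇒≤ s<j)))
    (beyond-off-middle (≤-trans (<⇒≤ s<j) j≤p) (λ _ → bk) λ s≡j → ⊥-elim (<-irrefl s≡j s<j))

  path-u-v : Beyond h (at P k) → Beyond h (at P j) → Path (Beyond h) u v
  path-u-v bk bj = path P λ 0<s s<p → beyond-off-middle (<⇒≤ s<p) (λ _ → bk) λ _ → bj

  close : ∀ {a b} → Dist G a x h → Dist G b x h → Path (Beyond h) a b → a ≡ b ⊎ Adj a b
  close = beyond-path⇒≡⊎adj chordal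

  adjacent-or-shared-ancestor : ∃₂ λ a b → Anc a u × Anc b v × (a ≡ b ⊎ Adj a b)
  adjacent-or-shared-ancestor
    with ancestor-or-beyond k≤p | ancestor-or-beyond j≤p
       | geodesic-ancestor du h<ℓ | geodesic-ancestor dv h<ℓ
  ... | inj₁ dk | inj₁ dj | _ | _ = _ , _ , ancestor-at-k dk , ancestor-at-j dj , consecutive-k-j
  ... | inj₁ dk | inj₂ bj | _ | b , B =
    _ , b , ancestor-at-k dk , B ,
    close dk (ancestor-dist B) (path-from-k bj ⟨ descendant-beyond B ⟩ ancestor-path B)
  ... | inj₂ bk | inj₁ dj | a , A | _ =
    a , _ , A , ancestor-at-j dj ,
    close (ancestor-dist A) dj (reversePath (ancestor-path A) ⟨ descendant-beyond A ⟩ path-to-j bk)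
  ... | inj₂ bk | inj₂ bj | a , A | b , B =
    a , b , A , B ,
    close (ancestor-dist A) (ancestor-dist B)
      (reversePath (ancestor-path A) ⟨ descendant-beyond A ⟩ path-u-v bk bj ⟨ descendant-beyond B ⟩
       ancestor-path B)

  no-shared-ancestor : k < j → ∀ w → ¬ (Anc w u × Anc w v)
  no-shared-ancestor k<j w (A , B) =
    <⇒≱ (+-monoʳ-< k k<j) (subst (λ i → p ≤ i + i) ℓ∸h≡k (shared-ancestor⇒dist≤ A B duv))

  adjacent-ancestor-cliques : k < j → AdjacentCliques G (λ w → Anc w u) (λ w → Anc w v)
  adjacent-ancestor-cliques k<j with adjacent-or-shared-ancestor
  ... | a , _ , A , B , inj₁ refl = ⊥-elim (no-shared-ancestor k<j a (A , B))
  ... | a , b , A , B , inj₂ ab = no-shared-ancestor k<j , a , b , A , B , ab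

  adjacent-or-intersecting-ancestor-cliques :
    AdjacentCliques G (λ w → Anc w u) (λ w → Anc w v) ⊎ Intersect G (λ w → Anc w u) (λ w → Anc w v)
  adjacent-or-intersecting-ancestor-cliques with adjacent-or-shared-ancestor
  ... | a , _ , A , B , inj₁ refl = inj₂ (a , A , B)
  ... | a , b , A , B , inj₂ ab with Fin.any? (λ w → ancestor? h ℓ w u ×-dec ancestor? h ℓ w v)
  ...   | yes shared = inj₂ shared
  ...   | no ∄ = inj₁ ((λ w AB → ∄ (w , AB)) , a , b , A , B , ab)

2≤n+[1+n]⇒0<n : ∀ {k} → 2 ≤ k + suc k → 0 < k
2≤n+[1+n]⇒0<n {zero} (s≤s ())
2≤n+[1+n]⇒0<n {suc k} _ = z<s

n≡[n/2]+[n%2+n/2] : ∀ n → n ≡ n / 2 + (n % 2 + n / 2)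
n≡[n/2]+[n%2+n/2] n = begin
  n                   ≡⟨ m≡m%n+[m/n]*n n 2 ⟩
  r + k * 2           ≡⟨ cong (r +_) (*-comm k 2) ⟩
  r + (k + (k + 0))   ≡⟨ cong (λ i → r + (k + i)) (+-identityʳ k) ⟩
  r + (k + k)         ≡⟨ +-assoc r k k ⟨
  r + k + k           ≡⟨ +-comm (r + k) k ⟩
  k + (r + k)         ∎
  where
  open ≡-Reasoning
  k = n / 2
  r = n % 2

lemma2p3 : (G : Graph) → Connected G → Chordal G →
    (x : Fin (Graph.n G)) (ℓ : ℕ) → 1 ≤ ℓ →
    (u v : Fin (Graph.n G)) → InN G ℓ x u → InN G ℓ x v →
    (p : ℕ) → Dist G u v p → 2 ≤ p →
    IsClique G (λ w → Ancestor G x (ℓ ∸ p / 2) ℓ w u) ×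
    IsClique G (λ w → Ancestor G x (ℓ ∸ p / 2) ℓ w v) ×
    (p % 2 ≡ 1 →
      AdjacentCliques G (λ w → Ancestor G x (ℓ ∸ p / 2) ℓ w u)
                        (λ w → Ancestor G x (ℓ ∸ p / 2) ℓ w v)) ×
    (p % 2 ≡ 0 →
      AdjacentCliques G (λ w → Ancestor G x (ℓ ∸ p / 2) ℓ w u)
                        (λ w → Ancestor G x (ℓ ∸ p / 2) ℓ w v)
      ⊎ Intersect G (λ w → Ancestor G x (ℓ ∸ p / 2) ℓ w u)
                    (λ w → Ancestor G x (ℓ ∸ p / 2) ℓ w v))
lemma2p3 G _ chordal x ℓ _ u v du dv p duv 2≤p =
  ancestors-isClique chordal , ancestors-isClique chordal ,
  (λ odd → adjacent-ancestor-cliques (subst (λ r → k < r + k) (sym odd) ≤-refl)) ,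
  λ _ → adjacent-or-intersecting-ancestor-cliques
  where
  open Layers G x using (ancestors-isClique)
  k j : ℕ
  k = p / 2
  j = p % 2 + k
  p≡k+j : p ≡ k + j
  p≡k+j = n≡[n/2]+[n%2+n/2] p
  j≤1+k : j ≤ suc k
  j≤1+k = +-monoˡ-≤ k (≤-pred (m%n<n p 2))
  0<k : 0 < k
  0<k = 2≤n+[1+n]⇒0<n (≤-trans 2≤p (≤-trans (≤-reflexive p≡k+j) (+-monoʳ-≤ k j≤1+k)))
  open Geodesic G chordal x du dv (subst (Dist G u v) p≡k+j duv) 0<k (m≤n+m k (p % 2)) j≤1+k
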